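{- Let $G=(V,E)$ be a graph of minimum degree at least $3$ and let $H_G$ be a cubic extension of $G$. (a) If $G$ is $3$-edge-connected and $G-v$ is connected for all $v\in V$, then $H_G$ is $3$-edge-connected. (b) If $G$ is essentially $4$-edge-connected and $G-v$ is $2$-edge-connected for all $v\in V$, then $H_G$ is essentially $4$-edge-connected.
   Context: Graphs are finite and undirected; parallel edges are allowed. For $X\subseteq V$, $\delta_G(X)$ is the set of edges with exactly one endvertex in $X$, $d_G(X)=|\delta_G(X)|$, and the degree of $v$ is $d_G(\{v\})$. $G$ is $k$-edge-connected if $d_G(X)\ge k$ for every nonempty proper $X\subseteq V$. $G$ is essentially $4$-edge-connected if it is $3$-edge-connected and for every $X$ with $d_G(X)=3$ one has $|X|=1$ or $|V-X|=1$. A cubic extension $H_G$ of $G$ is any graph constructed as follows: for each $v\in V$ of degree at least $4$ take a set $S_v$ of $d_G(\{v\})$ new vertices and add a cycle $C_v$ with vertex set $S_v$; for each vertex $v$ of degree $3$ let $S_v=\{v\}$; then for each edge $uv\in E$ add an edge between a vertex of $S_u$ and a vertex of $S_v$, chosen so that the resulting graph $H_G$ is cubic (every vertex has degree $3$). -}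

module Defs where

open import Data.Nat using (ℕ; zero; suc; _+_; _≤_)
open import Data.Fin using (Fin; zero; suc; _≟_)
open import Data.Bool using (Bool; true; false; if_then_else_; _xor_; _∧_; not)
open import Data.Product using (Σ; _×_; _,_; proj₁; proj₂)
open import Data.Sum using (_⊎_; inj₁; inj₂)
open import Relation.Binary.PropositionalEquality using (_≡_; _≢_)
open import Relation.Nullary.Decidable using (⌊_⌋)
open import Function.Definitions using (Injective)

record Graph : Set where
  field
    nV : ℕ
    mE : ℕ
    ends : Fin mE → Fin nV × Fin nV
    loopless : ∀ e → proj₁ (ends e) ≢ proj₂ (ends e)
open Graph public

count : ∀ {k} → (Fin k → Bool) → ℕ
count {zero} p = 0
count {suc k} p = (if p zero then 1 else 0) + count (λ i → p (suc i))

VSet : Graph → Set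
VSet G = Fin (nV G) → Bool

size : (G : Graph) → VSet G → ℕ
size G X = count X

compl : (G : Graph) → VSet G → VSet G
compl G X v = not (X v)

cut : (G : Graph) → VSet G → ℕ
cut G X = count (λ e → X (proj₁ (ends G e)) xor X (proj₂ (ends G e)))

singleton : (G : Graph) → Fin (nV G) → VSet G
singleton G v x = ⌊ x ≟ v ⌋

deg : (G : Graph) → Fin (nV G) → ℕ
deg G v = cut G (singleton G v)

MinDegAtLeast : ℕ → Graph → Set
MinDegAtLeast k G = ∀ v → k ≤ deg G v

NonemptyProper : (G : Graph) → VSet G → Set
NonemptyProper G X = Σ (Fin (nV G)) (λ x → X x ≡ true) × Σ (Fin (nV G)) (λ y → X y ≡ false)

EdgeConnected : ℕ → Graph → Set
EdgeConnected k G = ∀ (X : VSet G) → NonemptyProper G X → k ≤ cut G X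

Essentially4EdgeConnected : Graph → Set
Essentially4EdgeConnected G =
  EdgeConnected 3 G ×
  (∀ (X : VSet G) → cut G X ≡ 3 → size G X ≡ 1 ⊎ size G (compl G X) ≡ 1)

-- G - v: vertex set V - {v}, edge set = edges not incident with v.
-- A subset of V - {v} is represented by X : VSet G with X v ≡ false.
incident : (G : Graph) → Fin (nV G) → Fin (mE G) → Bool
incident G v e = ⌊ proj₁ (ends G e) ≟ v ⌋ Data.Bool.∨ ⌊ proj₂ (ends G e) ≟ v ⌋
  where import Data.Bool

cutDel : (G : Graph) → Fin (nV G) → VSet G → ℕ
cutDel G v X = count (λ e → not (incident G v e) ∧ (X (proj₁ (ends G e)) xor X (proj₂ (ends G e))))

DelEdgeConnected : ℕ → (G : Graph) → Fin (nV G) → Set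
DelEdgeConnected k G v =
  ∀ (X : VSet G) → X v ≡ false →
    Σ (Fin (nV G)) (λ x → X x ≡ true) →
    Σ (Fin (nV G)) (λ y → y ≢ v × X y ≡ false) →
    k ≤ cutDel G v X

DelConnected : (G : Graph) → Fin (nV G) → Set
DelConnected G v = DelEdgeConnected 1 G v

next : ∀ {k} → Fin (suc k) → Fin (suc k)
next {zero} zero = zero
next {suc k} zero = suc zero
next {suc k} (suc i) with next {k} i
... | zero = zero
... | suc j = suc (suc j)

EndsAre : (H : Graph) → Fin (mE H) → Fin (nV H) → Fin (nV H) → Set
EndsAre H f a b = ends H f ≡ (a , b) ⊎ ends H f ≡ (b , a)

-- C_v: vertices σ 0, …, σ k listing S_v bijectively (k+1 = d(v)),
-- edges τ i joining σ i and σ (i+1 mod k+1), listing exactly the edges of kind inj₂ v.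
record CycleAt (G H : Graph) (own : Fin (nV H) → Fin (nV G))
             (kind : Fin (mE H) → Fin (mE G) ⊎ Fin (nV G)) (v : Fin (nV G)) : Set where
  field
    k : ℕ
    k-deg : suc k ≡ deg G v
    σ : Fin (suc k) → Fin (nV H)
    σ-inj : Injective _≡_ _≡_ σ
    σ-own : ∀ i → own (σ i) ≡ v
    σ-onto : ∀ a → own a ≡ v → Σ (Fin (suc k)) (λ i → σ i ≡ a)
    τ : Fin (suc k) → Fin (mE H)
    τ-inj : Injective _≡_ _≡_ τ
    τ-kind : ∀ i → kind (τ i) ≡ inj₂ v
    τ-onto : ∀ f → kind f ≡ inj₂ v → Σ (Fin (suc k)) (λ i → τ i ≡ f)
    τ-ends : ∀ i → EndsAre H (τ i) (σ i) (σ (next i))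

-- Data of a cubic extension H of G (up to isomorphism of H):
-- own a = the vertex v with a ∈ S_v;
-- kind f = inj₁ e if f is the H-edge for the G-edge e, inj₂ v if f ∈ E(C_v).
record CubicExtension (G H : Graph) : Set where
  field
    own  : Fin (nV H) → Fin (nV G)
    kind : Fin (mE H) → Fin (mE G) ⊎ Fin (nV G)
    lift      : Fin (mE G) → Fin (mE H)
    lift-kind : ∀ e → kind (lift e) ≡ inj₁ e
    kind-lift : ∀ f e → kind f ≡ inj₁ e → f ≡ lift e
    lift-ends : ∀ e →
      (own (proj₁ (ends H (lift e))) , own (proj₂ (ends H (lift e)))) ≡ ends G e ⊎
      (own (proj₂ (ends H (lift e))) , own (proj₁ (ends H (lift e)))) ≡ ends G e
    deg3-vertex : ∀ v → deg G v ≡ 3 →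
      Σ (Fin (nV H)) (λ a → own a ≡ v × (∀ b → own b ≡ v → b ≡ a))
    deg3-nocycle : ∀ v → deg G v ≡ 3 → ∀ f → kind f ≢ inj₂ v
    big-cycle : ∀ v → 4 ≤ deg G v → CycleAt G H own kind v
    cubic : ∀ a → deg H a ≡ 3

module Submission where

-- Write S_u for the vertices of H owned by u ∈ V(G), and let X ⊆ V(H). If X splits no S_u, it is the
-- preimage of its projection W ⊆ V(G), and the injective lift of edges of G gives d_H(X) ≥ d_G(W).
-- If X splits S_v, then d(v) ≥ 4 and the cycle C_v crosses X twice; a second split class adds two
-- more crossings. Otherwise the lift edges leaving X ∩ S_v and S_v − X show that the projection of X
-- to G − v is a nonempty proper subset, so connectivity of G − v produces a crossing lift edge.
-- For a 3-cut X of H: if X splits no class, W is a trivial 3-cut of G, i.e. a vertex of degree 3,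
-- whose class is a single vertex. If X splits S_v, exactly one lift edge crosses X, so by
-- 2-edge-connectivity of G − v the projection is trivial there: X or its complement lies in S_v,
-- and each of its vertices is the endpoint in S_v of that single lift edge.

open import Defs
open import Data.Nat using (ℕ; zero; suc; _+_; _≤_; _≤?_; z≤n; s≤s)
open import Data.Nat.Properties
  using (≤-refl; ≤-trans; ≤-antisym; ≤-reflexive; ≰⇒>; m≤n⇒m<n∨m≡n; n≤1+n)
open import Data.Fin using (Fin; zero; suc; _≟_; inject≤; inject₁; fromℕ)
open import Data.Fin.Properties using (any?; injective⇒≤; inject≤-injective; suc-injective; ≤fromℕ)
import Data.Fin as Fin
open import Data.Bool using (Bool; true; false; not; _∧_; _xor_; if_then_else_)
open import Data.Bool.Properties using (xor-comm; xor-same; xor-annihilates-not; ¬-not; not-injective)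
  renaming (_≟_ to _≟ᵇ_)
open import Data.Product using (Σ; _×_; _,_; proj₁; proj₂; uncurry)
open import Data.Sum using (_⊎_; inj₁; inj₂)
import Data.Sum as Sum
open import Data.Sum.Properties using (inj₁-injective; inj₂-injective)
open import Function using (id; case_of_)
open import Data.Empty using (⊥; ⊥-elim)
open import Data.Vec using (Vec; []; _∷_; lookup)
open import Data.Vec.Relation.Unary.All using (All; []; _∷_)
open import Data.Vec.Relation.Unary.AllPairs using ([]; _∷_)
open import Data.Vec.Relation.Unary.All.Properties using (lookup⁺)
open import Data.Vec.Relation.Unary.Unique.Propositional using (Unique)
open import Data.Vec.Relation.Unary.Unique.Propositional.Properties using (lookup-injective)
open import Function.Definitions using (Injective)
open import Relation.Binary.PropositionalEquality
open import Relation.Nullary using (¬_; Dec; yes; no)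
open import Relation.Nullary.Decidable using (⌊_⌋; _×-dec_; ¬?)

rank : ∀ {k} (p : Fin k → Bool) (i : Fin k) → p i ≡ true → Fin (count p)
rank {suc k} p zero pi with p zero
... | true = zero
rank {suc k} p zero () | false
rank {suc k} p (suc i) pi with p zero
... | true = suc (rank (λ j → p (suc j)) i pi)
... | false = rank (λ j → p (suc j)) i pi

rank-injective : ∀ {k} (p : Fin k → Bool) {i j : Fin k} (pi : p i ≡ true) (pj : p j ≡ true) →
                  rank p i pi ≡ rank p j pj → i ≡ j
rank-injective {suc k} p {zero} {zero} pi pj eq = refl
rank-injective {suc k} p {zero} {suc j} pi pj eq with p zero
rank-injective {suc k} p {zero} {suc j} pi pj () | true
rank-injective {suc k} p {zero} {suc j} () pj eq | false
rank-injective {suc k} p {suc i} {zero} pi pj eq with p zero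
rank-injective {suc k} p {suc i} {zero} pi pj () | true
rank-injective {suc k} p {suc i} {zero} pi () eq | false
rank-injective {suc k} p {suc i} {suc j} pi pj eq with p zero
... | true = cong suc (rank-injective (λ j → p (suc j)) pi pj (suc-injective eq))
... | false = cong suc (rank-injective (λ j → p (suc j)) pi pj eq)

enumerate : ∀ {k} (p : Fin k → Bool) → Fin (count p) → Fin k
enumerate {suc k} p x with p zero
enumerate {suc k} p zero | true = zero
enumerate {suc k} p (suc x) | true = suc (enumerate (λ j → p (suc j)) x)
... | false = suc (enumerate (λ j → p (suc j)) x)

enumerate-sound : ∀ {k} (p : Fin k → Bool) (x : Fin (count p)) → p (enumerate p x) ≡ true
enumerate-sound {suc k} p x with p zero in eq
enumerate-sound {suc k} p zero | true = eq
enumerate-sound {suc k} p (suc x) | true = enumerate-sound (λ j → p (suc j)) x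
... | false = enumerate-sound (λ j → p (suc j)) x

enumerate-injective : ∀ {k} (p : Fin k → Bool) → Injective _≡_ _≡_ (enumerate p)
enumerate-injective {suc k} p {x} {y} eq with p zero
enumerate-injective {suc k} p {zero} {zero} eq | true = refl
enumerate-injective {suc k} p {suc x} {suc y} eq | true =
  cong suc (enumerate-injective (λ j → p (suc j)) (suc-injective eq))
... | false = enumerate-injective (λ j → p (suc j)) (suc-injective eq)

≤-count : ∀ {n k} {p : Fin k → Bool} (f : Fin n → Fin k) → Injective _≡_ _≡_ f →
          (∀ i → p (f i) ≡ true) → n ≤ count p
≤-count {p = p} f f-inj pf = injective⇒≤ (λ eq → f-inj (rank-injective p (pf _) (pf _) eq))

count-witnesses : ∀ {n k} (p : Fin k → Bool) → n ≤ count p →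
                  Σ (Fin n → Fin k) λ f → Injective _≡_ _≡_ f × (∀ i → p (f i) ≡ true)
count-witnesses p n≤ =
  (λ i → enumerate p (inject≤ i n≤)) ,
  (λ eq → inject≤-injective n≤ n≤ _ _ (enumerate-injective p eq)) ,
  (λ i → enumerate-sound p (inject≤ i n≤))

distinct-≤-count : ∀ {n k} {p : Fin k → Bool} (xs : Vec (Fin k) n) → Unique xs →
                   All (λ x → p x ≡ true) xs → n ≤ count p
distinct-≤-count xs xs-unique pxs =
  ≤-count (lookup xs) (λ {i} {j} → lookup-injective xs-unique i j) (lookup⁺ pxs)

witness : ∀ {k} (p : Fin k → Bool) → 1 ≤ count p → Σ (Fin k) λ i → p i ≡ true
witness p 1≤count = let f , _ , pf = count-witnesses p 1≤count in f zero , pf zero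

count-mono : ∀ {k m} {p : Fin k → Bool} {q : Fin m → Bool} (f : Fin k → Fin m) →
             Injective _≡_ _≡_ f → (∀ {i} → p i ≡ true → q (f i) ≡ true) → count p ≤ count q
count-mono {p = p} f f-inj pres with count-witnesses p ≤-refl
... | g , g-inj , pg = ≤-count (λ i → f (g i)) (λ eq → g-inj (f-inj eq)) (λ i → pres (pg i))

count-≤1 : ∀ {k} (p : Fin k → Bool) → (∀ {i j} → p i ≡ true → p j ≡ true → i ≡ j) →
           count p ≤ 1
count-≤1 p unique with count p ≤? 1
... | yes ≤1 = ≤1
... | no ≰1 with count-witnesses p (≰⇒> ≰1)
...   | f , f-inj , pf with f-inj (unique (pf zero) (pf (suc zero)))
...     | ()

count≡1 : ∀ {k} (p : Fin k → Bool) {a : Fin k} → p a ≡ true → (∀ {b} → p b ≡ true → b ≡ a) →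
          count p ≡ 1
count≡1 p {a} pa unique = ≤-antisym
  (count-≤1 p (λ pi pj → trans (unique pi) (sym (unique pj))))
  (≤-count (λ _ → a) (λ { {zero} {zero} _ → refl }) (λ _ → pa))

count≡1⇒unique : ∀ {k} (p : Fin k → Bool) → count p ≡ 1 →
                 Σ (Fin k) λ a → p a ≡ true × (∀ {b} → p b ≡ true → b ≡ a)
count≡1⇒unique p c≡1 with witness p (subst (1 ≤_) (sym c≡1) ≤-refl)
... | a , pa = a , pa , unique
  where
  unique : ∀ {b} → p b ≡ true → b ≡ a
  unique {b} pb with b ≟ a
  ... | yes b≡a = b≡a
  ... | no b≢a
    with subst (2 ≤_) c≡1 (distinct-≤-count (b ∷ a ∷ []) ((b≢a ∷ []) ∷ [] ∷ []) (pb ∷ pa ∷ []))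
  ...   | s≤s ()

count-ext : ∀ {k} {p q : Fin k → Bool} → (∀ i → p i ≡ q i) → count p ≡ count q
count-ext {zero} p≡q = refl
count-ext {suc k} {p} {q} p≡q rewrite p≡q zero = cong (_ +_) (count-ext (λ i → p≡q (suc i)))

count-false : ∀ {k} {p : Fin k → Bool} → (∀ i → p i ≡ false) → count p ≡ 0
count-false {zero} p≡false = refl
count-false {suc k} p≡false rewrite p≡false zero = count-false (λ i → p≡false (suc i))

xor≡false⇒≡ : ∀ a b → a xor b ≡ false → a ≡ b
xor≡false⇒≡ false false _ = refl
xor≡false⇒≡ true  true  _ = refl

next-injective : ∀ {k} → Injective _≡_ _≡_ (next {k})
next-injective {zero} {zero} {zero} _ = refl
next-injective {suc k} {zero} {zero} _ = refl
next-injective {suc k} {zero} {suc j} eq with next {k} j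
next-injective {suc k} {zero} {suc j} () | zero
next-injective {suc k} {zero} {suc j} () | suc _
next-injective {suc k} {suc i} {zero} eq with next {k} i
next-injective {suc k} {suc i} {zero} () | zero
next-injective {suc k} {suc i} {zero} () | suc _
next-injective {suc k} {suc i} {suc j} eq with next {k} i in ei | next {k} j in ej
... | zero  | zero  = cong suc (next-injective (trans ei (sym ej)))
... | suc _ | suc _ with eq
...   | refl = cong suc (next-injective (trans ei (sym ej)))

next-inject₁ : ∀ {k} (i : Fin k) → next (inject₁ i) ≡ suc i
next-inject₁ {suc k} zero = refl
next-inject₁ {suc k} (suc i) rewrite next-inject₁ i = refl

next-fromℕ : ∀ k → next (fromℕ k) ≡ zero
next-fromℕ zero = refl
next-fromℕ (suc k) rewrite next-fromℕ k = refl

ExitArc : ∀ {k} → (Fin (suc k) → Bool) → Set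
ExitArc {k} Z = Σ (Fin (suc k)) λ i → Z i ≡ true × Z (next i) ≡ false

path-exit : ∀ {k} (Z : Fin (suc k) → Bool) (x y : Fin (suc k)) → x Fin.≤ y →
            Z x ≡ true → Z y ≡ false →
            Σ (Fin k) λ i → Z (inject₁ i) ≡ true × Z (suc i) ≡ false
path-exit Z zero zero _ zx zy with trans (sym zx) zy
... | ()
path-exit {suc k} Z zero (suc y) _ zx zy with Z (suc zero) in z₁
... | false = zero , zx , z₁
... | true with path-exit (λ i → Z (suc i)) zero y z≤n z₁ zy
...   | i , zi , zsi = suc i , zi , zsi
path-exit {suc k} Z (suc x) (suc y) (s≤s x≤y) zx zy with path-exit (λ i → Z (suc i)) x y x≤y zx zy
... | i , zi , zsi = suc i , zi , zsi

path-exit⇒exitArc : ∀ {k} {Z : Fin (suc k) → Bool} →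
                    (Σ (Fin k) λ i → Z (inject₁ i) ≡ true × Z (suc i) ≡ false) → ExitArc Z
path-exit⇒exitArc {Z = Z} (i , zi , zsi) =
  inject₁ i , zi , subst (λ j → Z j ≡ false) (sym (next-inject₁ i)) zsi

-- Either Z is false at the last vertex and we walk up from x, or the arc k → 0 leaves Z,
-- or Z holds at 0 and we walk up from 0 to y.
exitArc : ∀ {k} (Z : Fin (suc k) → Bool) {x y} → Z x ≡ true → Z y ≡ false → ExitArc Z
exitArc {k} Z {x} {y} zx zy with Z (fromℕ k) in zℓ | Z zero in z₀
... | false | _     = path-exit⇒exitArc (path-exit Z x (fromℕ k) (≤fromℕ x) zx zℓ)
... | true  | false = fromℕ k , zℓ , trans (cong Z (next-fromℕ k)) z₀
... | true  | true  = path-exit⇒exitArc (path-exit Z zero y z≤n z₀ zy)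

Touches : ∀ {k} → Fin (suc k) → Fin (suc k) → Set
Touches i j = j ≡ i ⊎ j ≡ next i

at-most-two-arcs : ∀ {k} {j i₀ i₁ i₂ : Fin (suc k)} →
                   Touches i₀ j → Touches i₁ j → Touches i₂ j →
                   i₀ ≢ i₁ → i₀ ≢ i₂ → i₁ ≢ i₂ → ⊥
at-most-two-arcs (inj₁ a) (inj₁ b) _        i₀≢i₁ _     _     = i₀≢i₁ (trans (sym a) b)
at-most-two-arcs (inj₂ a) (inj₂ b) _        i₀≢i₁ _     _     = i₀≢i₁ (next-injective (trans (sym a) b))
at-most-two-arcs (inj₁ a) (inj₂ b) (inj₁ c) _     i₀≢i₂ _     = i₀≢i₂ (trans (sym a) c)
at-most-two-arcs (inj₁ a) (inj₂ b) (inj₂ c) _     _     i₁≢i₂ = i₁≢i₂ (next-injective (trans (sym b) c))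
at-most-two-arcs (inj₂ a) (inj₁ b) (inj₁ c) _     _     i₁≢i₂ = i₁≢i₂ (trans (sym b) c)
at-most-two-arcs (inj₂ a) (inj₁ b) (inj₂ c) _     i₀≢i₂ _     = i₀≢i₂ (next-injective (trans (sym a) c))

-- cut Γ X unfolds definitionally to count (crosses Γ X).
crosses : (Γ : Graph) → VSet Γ → Fin (mE Γ) → Bool
crosses Γ X e = X (proj₁ (ends Γ e)) xor X (proj₂ (ends Γ e))

module _ (Γ : Graph) (e : Fin (mE Γ)) where

  EndsAre-self : EndsAre Γ e (proj₁ (ends Γ e)) (proj₂ (ends Γ e))
  EndsAre-self = inj₁ refl

  EndsAre-≢ : ∀ {a b} → EndsAre Γ e a b → a ≢ b
  EndsAre-≢ (inj₁ h) a≡b = loopless Γ e (trans (cong proj₁ h) (trans a≡b (sym (cong proj₂ h))))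
  EndsAre-≢ (inj₂ h) a≡b = loopless Γ e (trans (cong proj₁ h) (trans (sym a≡b) (sym (cong proj₂ h))))

  EndsAre-endpoint : ∀ {s t a b} → EndsAre Γ e s t → EndsAre Γ e a b → a ≡ s ⊎ a ≡ t
  EndsAre-endpoint (inj₁ h) (inj₁ h′) = inj₁ (cong proj₁ (trans (sym h′) h))
  EndsAre-endpoint (inj₁ h) (inj₂ h′) = inj₂ (cong proj₂ (trans (sym h′) h))
  EndsAre-endpoint (inj₂ h) (inj₁ h′) = inj₂ (cong proj₁ (trans (sym h′) h))
  EndsAre-endpoint (inj₂ h) (inj₂ h′) = inj₁ (cong proj₂ (trans (sym h′) h))

  EndsAre-transfer : (P : Fin (nV Γ) → Set) → ∀ {a b c d} → EndsAre Γ e a b → EndsAre Γ e c d →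
                     P a → P b → P c × P d
  EndsAre-transfer P {a} {b} ab cd pa pb =
    holds (EndsAre-endpoint ab cd) , holds (EndsAre-endpoint ab (Sum.swap cd))
    where
    holds : ∀ {x} → x ≡ a ⊎ x ≡ b → P x
    holds (inj₁ refl) = pa
    holds (inj₂ refl) = pb

  crosses-EndsAre : (X : VSet Γ) → ∀ {a b} → EndsAre Γ e a b → crosses Γ X e ≡ X a xor X b
  crosses-EndsAre X (inj₁ h) = cong (λ p → X (proj₁ p) xor X (proj₂ p)) h
  crosses-EndsAre X {a} {b} (inj₂ h) =
    trans (cong (λ p → X (proj₁ p) xor X (proj₂ p)) h) (xor-comm (X b) (X a))

  uncrossed-EndsAre : (X : VSet Γ) → ∀ {a b} → crosses Γ X e ≡ false → EndsAre Γ e a b → X a ≡ X b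
  uncrossed-EndsAre X ¬crossed ab = xor≡false⇒≡ _ _ (trans (sym (crosses-EndsAre X ab)) ¬crossed)

  crosses-singleton⇒EndsAre : ∀ {a} → crosses Γ (singleton Γ a) e ≡ true →
                              Σ (Fin (nV Γ)) λ b → EndsAre Γ e a b
  crosses-singleton⇒EndsAre {a} h with proj₁ (ends Γ e) ≟ a
  ... | yes p = proj₂ (ends Γ e) , inj₁ (cong (_, proj₂ (ends Γ e)) p)
  ... | no _ with proj₂ (ends Γ e) ≟ a
  ...   | yes q = proj₁ (ends Γ e) , inj₂ (cong (proj₁ (ends Γ e) ,_) q)
  crosses-singleton⇒EndsAre () | no _ | no _

module _ (Γ : Graph) where

  cut-ext : ∀ {X Y : VSet Γ} → (∀ a → X a ≡ Y a) → cut Γ X ≡ cut Γ Y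
  cut-ext X≡Y = count-ext (λ e → cong₂ _xor_ (X≡Y (proj₁ (ends Γ e))) (X≡Y (proj₂ (ends Γ e))))

  crosses-compl : ∀ X e → crosses Γ (compl Γ X) e ≡ crosses Γ X e
  crosses-compl X e = xor-annihilates-not (X (proj₁ (ends Γ e))) (X (proj₂ (ends Γ e)))

  cut-compl : ∀ X → cut Γ (compl Γ X) ≡ cut Γ X
  cut-compl X = count-ext (crosses-compl X)

  cut-const : ∀ {X : VSet Γ} b → (∀ a → X a ≡ b) → cut Γ X ≡ 0
  cut-const b X≡b =
    count-false (λ e → trans (cong₂ _xor_ (X≡b (proj₁ (ends Γ e))) (X≡b (proj₂ (ends Γ e)))) (xor-same b))

  unique⇒≡singleton : ∀ {W : VSet Γ} {u} → W u ≡ true → (∀ {x} → W x ≡ true → x ≡ u) →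
                      ∀ x → W x ≡ singleton Γ u x
  unique⇒≡singleton {W} {u} wu W⊆u x with x ≟ u
  ... | yes refl = wu
  ... | no x≢u = ¬-not (λ wx → x≢u (W⊆u wx))

  ¬incident⇒ends≢ : ∀ v e → incident Γ v e ≡ false →
                    proj₁ (ends Γ e) ≢ v × proj₂ (ends Γ e) ≢ v
  ¬incident⇒ends≢ v e ¬inc with proj₁ (ends Γ e) ≟ v | proj₂ (ends Γ e) ≟ v
  ... | no e₁≢v | no e₂≢v = e₁≢v , e₂≢v
  ¬incident⇒ends≢ v e () | yes _ | _
  ¬incident⇒ends≢ v e () | no _ | yes _

  delEdgeConnected-mono : ∀ {m n v} → m ≤ n → DelEdgeConnected n Γ v → DelEdgeConnected m Γ v
  delEdgeConnected-mono m≤n conn X Xv inside outside = ≤-trans m≤n (conn X Xv inside outside)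

  cut≢0⇒nonemptyProper : ∀ X → cut Γ X ≢ 0 → NonemptyProper Γ X
  cut≢0⇒nonemptyProper X cut≢0 with any? (λ a → X a ≟ᵇ true) | any? (λ a → X a ≟ᵇ false)
  ... | yes inside | yes outside = inside , outside
  ... | no none | _ = ⊥-elim (cut≢0 (cut-const false (λ a → ¬-not (λ t → none (a , t)))))
  ... | _ | no none = ⊥-elim (cut≢0 (cut-const true (λ a → ¬-not (λ f → none (a , f)))))

module CubicExtensionProperties {G H : Graph} (minDeg : MinDegAtLeast 3 G) (ext : CubicExtension G H) where
  open CubicExtension ext
  open CycleAt

  deg≡3⊎4≤deg : ∀ v → deg G v ≡ 3 ⊎ 4 ≤ deg G v
  deg≡3⊎4≤deg v with m≤n⇒m<n∨m≡n (minDeg v)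
  ... | inj₁ 3<deg = inj₂ 3<deg
  ... | inj₂ 3≡deg = inj₁ (sym 3≡deg)

  lift-injective : Injective _≡_ _≡_ lift
  lift-injective {e} {e′} eq = inj₁-injective (trans (sym (lift-kind e)) (trans (cong kind eq) (lift-kind e′)))

  lift-EndsAre : ∀ e {a b} → EndsAre H (lift e) a b → EndsAre G e (own a) (own b)
  lift-EndsAre e = Sum.[ along , (λ h → Sum.swap (along h)) ]
    where
    along : ∀ {a b} → ends H (lift e) ≡ (a , b) → EndsAre G e (own a) (own b)
    along h = subst₂ (EndsAre G e) (cong (λ p → own (proj₁ p)) h) (cong (λ p → own (proj₂ p)) h)
                     (Sum.map sym sym (lift-ends e))

  lift-ends-apart : ∀ e {a b} → EndsAre H (lift e) a b → own a ≢ own b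
  lift-ends-apart e ea = EndsAre-≢ G e (lift-EndsAre e ea)

  crosses-lift : ∀ (W : VSet G) (X : VSet H) e →
                 W (own (proj₁ (ends H (lift e)))) ≡ X (proj₁ (ends H (lift e))) →
                 W (own (proj₂ (ends H (lift e)))) ≡ X (proj₂ (ends H (lift e))) →
                 crosses G W e ≡ crosses H X (lift e)
  crosses-lift W X e W≡X₁ W≡X₂ =
    trans (crosses-EndsAre G e W (lift-EndsAre e (EndsAre-self H (lift e)))) (cong₂ _xor_ W≡X₁ W≡X₂)

  cycle-edge-ends : ∀ f {w} → kind f ≡ inj₂ w →
                    own (proj₁ (ends H f)) ≡ w × own (proj₂ (ends H f)) ≡ w
  cycle-edge-ends f {w} kf with deg≡3⊎4≤deg w
  ... | inj₁ d≡3 = ⊥-elim (deg3-nocycle w d≡3 f kf)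
  ... | inj₂ 4≤d with τ-onto (big-cycle w 4≤d) f kf
  ...   | i , refl =
    EndsAre-transfer H f (λ c → own c ≡ w) (τ-ends C i) (EndsAre-self H f) (σ-own C i) (σ-own C (next i))
    where C = big-cycle w 4≤d

  cycle-edge≢lift : ∀ {v} (4≤d : 4 ≤ deg G v) i e → τ (big-cycle v 4≤d) i ≢ lift e
  cycle-edge≢lift 4≤d i e eq with trans (sym (τ-kind (big-cycle _ 4≤d) i)) (trans (cong kind eq) (lift-kind e))
  ... | ()

  cycle-edges-apart : ∀ {v w} (4≤dv : 4 ≤ deg G v) (4≤dw : 4 ≤ deg G w) i j → v ≢ w →
                      τ (big-cycle v 4≤dv) i ≢ τ (big-cycle w 4≤dw) j
  cycle-edges-apart 4≤dv 4≤dw i j v≢w eq =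
    v≢w (inj₂-injective (trans (sym (τ-kind (big-cycle _ 4≤dv) i))
                               (trans (cong kind eq) (τ-kind (big-cycle _ 4≤dw) j))))

  LiftEdgeAt : Fin (nV H) → Set
  LiftEdgeAt a = Σ (Fin (mE G)) λ e → Σ (Fin (nV H)) λ b → EndsAre H (lift e) a b

  lift-or-cycle-edge : ∀ f {a b} → EndsAre H f a b → LiftEdgeAt a ⊎ kind f ≡ inj₂ (own a)
  lift-or-cycle-edge f {a} {b} ea with kind f in kf
  ... | inj₁ e with kind-lift f e kf
  ...   | refl = inj₁ (e , b , ea)
  lift-or-cycle-edge f {a} ea | inj₂ w with EndsAre-endpoint H f (EndsAre-self H f) ea | cycle-edge-ends f kf
  ... | inj₁ a≡e₁ | own≡w , _ = inj₂ (cong inj₂ (sym (trans (cong own a≡e₁) own≡w)))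
  ... | inj₂ a≡e₂ | _ , own≡w = inj₂ (cong inj₂ (sym (trans (cong own a≡e₂) own≡w)))

  ¬three-cycle-edges-at : ∀ a {f₀ f₁ f₂ b₀ b₁ b₂} →
    kind f₀ ≡ inj₂ (own a) → kind f₁ ≡ inj₂ (own a) → kind f₂ ≡ inj₂ (own a) →
    EndsAre H f₀ a b₀ → EndsAre H f₁ a b₁ → EndsAre H f₂ a b₂ →
    f₀ ≢ f₁ → f₀ ≢ f₂ → f₁ ≢ f₂ → ⊥
  ¬three-cycle-edges-at a k₀ k₁ k₂ e₀ e₁ e₂ f₀≢f₁ f₀≢f₂ f₁≢f₂
    with deg≡3⊎4≤deg (own a)
  ... | inj₁ d≡3 = deg3-nocycle (own a) d≡3 _ k₀
  ... | inj₂ 4≤d =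
    at-most-two-arcs (touches k₀ e₀) (touches k₁ e₁) (touches k₂ e₂)
      (apart k₀ k₁ f₀≢f₁) (apart k₀ k₂ f₀≢f₂) (apart k₁ k₂ f₁≢f₂)
    where
    C = big-cycle (own a) 4≤d
    j = proj₁ (σ-onto C a refl)
    arc : ∀ {f} → kind f ≡ inj₂ (own a) → Fin (suc (k C))
    arc kf = proj₁ (τ-onto C _ kf)
    touches : ∀ {f b} (kf : kind f ≡ inj₂ (own a)) → EndsAre H f a b → Touches (arc kf) j
    touches {f} kf ea with τ-onto C f kf
    ... | i , refl = Sum.map (λ eq → σ-inj C (trans σj≡a eq)) (λ eq → σ-inj C (trans σj≡a eq))
                             (EndsAre-endpoint H (τ C i) (τ-ends C i) ea)
      where σj≡a = proj₂ (σ-onto C a refl)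
    apart : ∀ {f f′} (kf : kind f ≡ inj₂ (own a)) (kf′ : kind f′ ≡ inj₂ (own a)) →
            f ≢ f′ → arc kf ≢ arc kf′
    apart kf kf′ f≢f′ eq =
      f≢f′ (trans (sym (proj₂ (τ-onto C _ kf))) (trans (cong (τ C) eq) (proj₂ (τ-onto C _ kf′))))

  -- a has three incident edges, at most two of which lie on C_(own a).
  lift-edge-at : ∀ a → LiftEdgeAt a
  lift-edge-at a with count-witnesses (crosses H (singleton H a)) (subst (3 ≤_) (sym (cubic a)) ≤-refl)
  ... | g , g-inj , g-at = pick (classify zero) (classify (suc zero)) (classify (suc (suc zero)))
    where
    at : ∀ r → Σ (Fin (nV H)) λ b → EndsAre H (g r) a b
    at r = crosses-singleton⇒EndsAre H (g r) (g-at r)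
    classify : ∀ r → LiftEdgeAt a ⊎ kind (g r) ≡ inj₂ (own a)
    classify r = lift-or-cycle-edge (g r) (proj₂ (at r))
    distinct : ∀ {r s} → r ≢ s → g r ≢ g s
    distinct r≢s eq = r≢s (g-inj eq)
    pick : LiftEdgeAt a ⊎ kind (g zero) ≡ inj₂ (own a) →
           LiftEdgeAt a ⊎ kind (g (suc zero)) ≡ inj₂ (own a) →
           LiftEdgeAt a ⊎ kind (g (suc (suc zero))) ≡ inj₂ (own a) → LiftEdgeAt a
    pick (inj₁ l) _ _ = l
    pick (inj₂ _) (inj₁ l) _ = l
    pick (inj₂ _) (inj₂ _) (inj₁ l) = l
    pick (inj₂ k₀) (inj₂ k₁) (inj₂ k₂) =
      ⊥-elim (¬three-cycle-edges-at a k₀ k₁ k₂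
               (proj₂ (at zero)) (proj₂ (at (suc zero))) (proj₂ (at (suc (suc zero))))
               (distinct (λ ())) (distinct (λ ())) (distinct (λ ())))

  lift-neighbour : ∀ a → Σ (Fin (mE G)) λ e → Σ (Fin (nV H)) λ c →
                   EndsAre H (lift e) a c × own a ≢ own c
  lift-neighbour a with lift-edge-at a
  ... | e , c , ea = e , c , ea , lift-ends-apart e ea

  Split : VSet H → Fin (nV G) → Set
  Split X u = Σ (Fin (nV H)) λ a → Σ (Fin (nV H)) λ b →
              own a ≡ u × own b ≡ u × X a ≡ true × X b ≡ false

  split? : ∀ X u → Dec (Split X u)
  split? X u with any? (λ a → (own a ≟ u) ×-dec (X a ≟ᵇ true))
                | any? (λ b → (own b ≟ u) ×-dec (X b ≟ᵇ false))
  ... | yes (a , a∈u , xa) | yes (b , b∈u , xb) = yes (a , b , a∈u , b∈u , xa , xb)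
  ... | no none-in | _ = no λ (a , _ , a∈u , _ , xa , _) → none-in (a , a∈u , xa)
  ... | _ | no none-out = no λ (_ , b , _ , b∈u , _ , xb) → none-out (b , b∈u , xb)

  Unsplit : VSet H → Fin (nV G) → Set
  Unsplit X u = ∀ {a b} → own a ≡ u → own b ≡ u → X a ≡ X b

  ¬split⇒unsplit : ∀ {X u} → ¬ Split X u → Unsplit X u
  ¬split⇒unsplit {X} ¬split {a} {b} a∈u b∈u with X a in xa | X b in xb
  ... | true  | true  = refl
  ... | false | false = refl
  ... | true  | false = ⊥-elim (¬split (a , b , a∈u , b∈u , xa , xb))
  ... | false | true  = ⊥-elim (¬split (b , a , b∈u , a∈u , xb , xa))

  Saturated : VSet H → Set
  Saturated X = ∀ u → Unsplit X u

  SaturatedAway : VSet H → Fin (nV G) → Set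
  SaturatedAway X v = ∀ u → u ≢ v → Unsplit X u

  meets? : (X : VSet H) (u : Fin (nV G)) → Dec (Σ (Fin (nV H)) λ a → own a ≡ u × X a ≡ true)
  meets? X u = any? (λ a → (own a ≟ u) ×-dec (X a ≟ᵇ true))

  project : VSet H → VSet G
  project X u = ⌊ meets? X u ⌋

  project-own : ∀ X {a} → Unsplit X (own a) → project X (own a) ≡ X a
  project-own X {a} unsplit with meets? X (own a) | X a in xa
  ... | yes _                | true  = refl
  ... | no none              | true  = ⊥-elim (none (a , refl , xa))
  ... | yes (b , b∈u , xb)   | false = trans (sym xb) (trans (unsplit b∈u refl) xa)
  ... | no _                 | false = refl

  cut≤cut-lifted : ∀ (W : VSet G) (X : VSet H) → (∀ a → W (own a) ≡ X a) → cut G W ≤ cut H X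
  cut≤cut-lifted W X W≡X =
    count-mono lift lift-injective (λ {e} c → trans (sym (crosses-lift W X e (W≡X _) (W≡X _))) c)

  saturated-project : ∀ {X} → Saturated X → ∀ a → project X (own a) ≡ X a
  saturated-project sat a = project-own _ (sat (own a))

  saturated-nonemptyProper : ∀ {X} → Saturated X → NonemptyProper H X → NonemptyProper G (project X)
  saturated-nonemptyProper sat ((x , xx) , (y , xy)) =
    (own x , trans (saturated-project sat x) xx) , (own y , trans (saturated-project sat y) xy)

  record CycleCut (X : VSet H) (v : Fin (nV G)) : Set where
    field
      large    : 4 ≤ deg G v
      i₁ i₂    : Fin (suc (k (big-cycle v large)))
      i₁≢i₂    : i₁ ≢ i₂
      crosses₁ : crosses H X (τ (big-cycle v large) i₁) ≡ true
      crosses₂ : crosses H X (τ (big-cycle v large) i₂) ≡ true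

    edges-apart : τ (big-cycle v large) i₁ ≢ τ (big-cycle v large) i₂
    edges-apart eq = i₁≢i₂ (τ-inj (big-cycle v large) eq)

  split⇒cycleCut : ∀ {X v} → Split X v → CycleCut X v
  split⇒cycleCut {X} {v} (a , b , a∈v , b∈v , xa , xb) with deg≡3⊎4≤deg v
  ... | inj₁ d≡3 with deg3-vertex v d≡3
  ...   | _ , _ , only = case trans (sym xa) (trans (cong X (trans (only a a∈v) (sym (only b b∈v)))) xb) of λ ()
  split⇒cycleCut {X} {v} (a , b , a∈v , b∈v , xa , xb) | inj₂ 4≤d = record
    { large = 4≤d
    ; i₁ = i₁ ; i₂ = i₂
    ; i₁≢i₂ = λ eq → case trans (sym zi₁) (trans (cong Z eq) zi₂) of λ ()
    ; crosses₁ = trans (arc-crosses i₁) (cong₂ _xor_ zi₁ zi₁⁺)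
    ; crosses₂ = trans (arc-crosses i₂) (cong₂ _xor_ zi₂ zi₂⁺)
    }
    where
    C = big-cycle v 4≤d
    Z : Fin (suc (k C)) → Bool
    Z i = X (σ C i)
    arc-crosses : ∀ i → crosses H X (τ C i) ≡ Z i xor Z (next i)
    arc-crosses i = crosses-EndsAre H (τ C i) X (τ-ends C i)
    ia = σ-onto C a a∈v
    ib = σ-onto C b b∈v
    za : Z (proj₁ ia) ≡ true
    za = trans (cong X (proj₂ ia)) xa
    zb : Z (proj₁ ib) ≡ false
    zb = trans (cong X (proj₂ ib)) xb
    leaving = exitArc Z za zb
    entering = exitArc (λ i → not (Z i)) (cong not zb) (cong not za)
    i₁ = proj₁ leaving
    i₂ = proj₁ entering
    zi₁ : Z i₁ ≡ true
    zi₁ = proj₁ (proj₂ leaving)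
    zi₁⁺ : Z (next i₁) ≡ false
    zi₁⁺ = proj₂ (proj₂ leaving)
    zi₂ : Z i₂ ≡ false
    zi₂ = not-injective (proj₁ (proj₂ entering))
    zi₂⁺ : Z (next i₂) ≡ true
    zi₂⁺ = not-injective (proj₂ (proj₂ entering))

  cycleCut+lift : ∀ {X v e} → CycleCut X v → crosses H X (lift e) ≡ true → 3 ≤ cut H X
  cycleCut+lift {e = e} cc ce =
    distinct-≤-count (τ C i₁ ∷ τ C i₂ ∷ lift e ∷ [])
      ((edges-apart ∷ cycle-edge≢lift large i₁ e ∷ []) ∷
       (cycle-edge≢lift large i₂ e ∷ []) ∷ [] ∷ [])
      (crosses₁ ∷ crosses₂ ∷ ce ∷ [])
    where
    open CycleCut cc
    C = big-cycle _ large

  cycleCut+two-lifts : ∀ {X v e e′} → CycleCut X v → e ≢ e′ →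
                       crosses H X (lift e) ≡ true → crosses H X (lift e′) ≡ true → 4 ≤ cut H X
  cycleCut+two-lifts {e = e} {e′} cc e≢e′ ce ce′ =
    distinct-≤-count (τ C i₁ ∷ τ C i₂ ∷ lift e ∷ lift e′ ∷ [])
      ((edges-apart ∷ cycle-edge≢lift large i₁ e ∷ cycle-edge≢lift large i₁ e′ ∷ []) ∷
       (cycle-edge≢lift large i₂ e ∷ cycle-edge≢lift large i₂ e′ ∷ []) ∷
       ((λ eq → e≢e′ (lift-injective eq)) ∷ []) ∷ [] ∷ [])
      (crosses₁ ∷ crosses₂ ∷ ce ∷ ce′ ∷ [])
    where
    open CycleCut cc
    C = big-cycle _ large

  two-cycleCuts : ∀ {X v w} → v ≢ w → CycleCut X v → CycleCut X w → 4 ≤ cut H X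
  two-cycleCuts v≢w ccv ccw =
    distinct-≤-count (τ Cv V.i₁ ∷ τ Cv V.i₂ ∷ τ Cw W.i₁ ∷ τ Cw W.i₂ ∷ [])
      ((V.edges-apart ∷ apart V.i₁ W.i₁ ∷ apart V.i₁ W.i₂ ∷ []) ∷
       (apart V.i₂ W.i₁ ∷ apart V.i₂ W.i₂ ∷ []) ∷
       (W.edges-apart ∷ []) ∷ [] ∷ [])
      (V.crosses₁ ∷ V.crosses₂ ∷ W.crosses₁ ∷ W.crosses₂ ∷ [])
    where
    module V = CycleCut ccv
    module W = CycleCut ccw
    Cv = big-cycle _ V.large
    Cw = big-cycle _ W.large
    apart : ∀ i j → τ Cv i ≢ τ Cw j
    apart i j = cycle-edges-apart V.large W.large i j v≢w

  saturated-cut : ∀ {X} → Saturated X → cut G (project X) ≤ cut H X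
  saturated-cut {X} sat = cut≤cut-lifted (project X) X (saturated-project sat)

  projectAway : VSet H → Fin (nV G) → VSet G
  projectAway X v u = if ⌊ u ≟ v ⌋ then false else project X u

  projectAway-self : ∀ X v → projectAway X v v ≡ false
  projectAway-self X v with v ≟ v
  ... | yes _ = refl
  ... | no v≢v = ⊥-elim (v≢v refl)

  projectAway-own : ∀ {X v} → SaturatedAway X v → ∀ {c} → own c ≢ v → projectAway X v (own c) ≡ X c
  projectAway-own {X} {v} sat {c} c∉v with own c ≟ v
  ... | yes c∈v = ⊥-elim (c∉v c∈v)
  ... | no _ = project-own X (sat (own c) c∉v)

  confined : ∀ {X v} → SaturatedAway X v → ∀ {β} →
             ¬ (Σ (Fin (nV G)) λ u → u ≢ v × projectAway X v u ≡ β) →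
             ∀ {c} → X c ≡ β → own c ≡ v
  confined {v = v} sat none {c} xc with own c ≟ v
  ... | yes c∈v = c∈v
  ... | no c∉v = ⊥-elim (none (own c , c∉v , trans (projectAway-own sat c∉v) xc))

  cutDel≤lift-crossings : ∀ {X v} → SaturatedAway X v →
                          cutDel G v (projectAway X v) ≤ count (λ e → crosses H X (lift e))
  cutDel≤lift-crossings {X} {v} sat = count-mono {q = λ e → crosses H X (lift e)} id (λ eq → eq) lifted
    where
    lifted : ∀ {e} → (not (incident G v e) ∧ crosses G (projectAway X v) e) ≡ true →
             crosses H X (lift e) ≡ true
    lifted {e} c with incident G v e in ¬inc
    ... | false
      with EndsAre-transfer G e (_≢ v) (EndsAre-self G e) (lift-EndsAre e (EndsAre-self H (lift e)))
                            (proj₁ ends∉v) (proj₂ ends∉v)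
      where ends∉v = ¬incident⇒ends≢ G v e ¬inc
    ...   | own₁∉v , own₂∉v =
      trans (sym (crosses-lift (projectAway X v) X e (projectAway-own sat own₁∉v) (projectAway-own sat own₂∉v))) c

  split⇒lift-crossing : ∀ {X v} → Split X v → SaturatedAway X v → DelConnected G v →
                        Σ (Fin (mE G)) λ e → crosses H X (lift e) ≡ true
  split⇒lift-crossing {X} {v} (a , b , a∈v , b∈v , xa , xb) sat conn
    with lift-neighbour a | lift-neighbour b
  ... | e , c , ac , a≁c | e′ , c′ , bc′ , b≁c′
    with crosses H X (lift e) in ce | crosses H X (lift e′) in ce′
  ...   | true  | _     = e , ce
  ...   | false | true  = e′ , ce′
  ...   | false | false =
    witness _ (≤-trans (conn (projectAway X v) (projectAway-self X v)
                             (own c , c-in) (own c′ , c′∉v , c′-out))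
                       (cutDel≤lift-crossings sat))
    where
    c∉v : own c ≢ v
    c∉v c∈v = a≁c (trans a∈v (sym c∈v))
    c′∉v : own c′ ≢ v
    c′∉v c′∈v = b≁c′ (trans b∈v (sym c′∈v))
    c-in : projectAway X v (own c) ≡ true
    c-in = trans (projectAway-own sat c∉v) (trans (sym (uncrossed-EndsAre H (lift e) X ce ac)) xa)
    c′-out : projectAway X v (own c′) ≡ false
    c′-out = trans (projectAway-own sat c′∉v) (trans (sym (uncrossed-EndsAre H (lift e′) X ce′ bc′)) xb)

  split-elsewhere? : ∀ X v → Dec (Σ (Fin (nV G)) λ w → w ≢ v × Split X w)
  split-elsewhere? X v = any? (λ w → ¬? (w ≟ v) ×-dec split? X w)

  no-split⇒saturated : ∀ {X} → ¬ (Σ (Fin (nV G)) (Split X)) → Saturated X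
  no-split⇒saturated none u = ¬split⇒unsplit (λ s → none (u , s))

  no-split-elsewhere⇒saturatedAway : ∀ {X v} → ¬ (Σ (Fin (nV G)) λ w → w ≢ v × Split X w) →
                                     SaturatedAway X v
  no-split-elsewhere⇒saturatedAway none u u≢v = ¬split⇒unsplit (λ s → none (u , u≢v , s))

  edgeConnected : EdgeConnected 3 G → (∀ v → DelConnected G v) → EdgeConnected 3 H
  edgeConnected ec conn X nonemptyProper with any? (split? X)
  ... | no none = ≤-trans (ec (project X) (saturated-nonemptyProper sat nonemptyProper)) (saturated-cut sat)
    where sat = no-split⇒saturated none
  ... | yes (v , s) with split-elsewhere? X v
  ...   | yes (w , w≢v , s′) =
    ≤-trans (n≤1+n 3) (two-cycleCuts (≢-sym w≢v) (split⇒cycleCut s) (split⇒cycleCut s′))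
  ...   | no none = cycleCut+lift (split⇒cycleCut s)
                      (proj₂ (split⇒lift-crossing s (no-split-elsewhere⇒saturatedAway none) (conn v)))

  singleton-lift : ∀ (W : VSet G) (Z : VSet H) → (∀ a → W (own a) ≡ Z a) →
                   size G W ≡ 1 → cut G W ≡ 3 → size H Z ≡ 1
  singleton-lift W Z W≡Z size≡1 cut≡3 =
    let u , wu , W⊆u = count≡1⇒unique W size≡1
        a , a∈u , only = deg3-vertex u (trans (sym (cut-ext G (unique⇒≡singleton G wu W⊆u))) cut≡3)
    in count≡1 Z (trans (sym (W≡Z a)) (trans (cong W a∈u) wu))
                 (λ {c} zc → only c (W⊆u (trans (W≡Z c) zc)))

  inside-class-size : ∀ (Z : VSet H) {v e₀ a} → (∀ {c} → Z c ≡ true → own c ≡ v) →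
                      (∀ {e} → crosses H Z (lift e) ≡ true → e ≡ e₀) → Z a ≡ true → size H Z ≡ 1
  inside-class-size Z {v} {e₀} {a} Z⊆v only-e₀ za = count≡1 Z za unique
    where
    on-e₀ : ∀ {c} → Z c ≡ true → Σ (Fin (nV H)) λ d → EndsAre H (lift e₀) c d × own c ≢ own d
    on-e₀ {c} zc with lift-neighbour c
    ... | e , d , cd , c≁d with only-e₀ (trans (crosses-EndsAre H (lift e) Z cd) (cong₂ _xor_ zc zd))
      where
      zd : Z d ≡ false
      zd = ¬-not (λ zd → c≁d (trans (Z⊆v zc) (sym (Z⊆v zd))))
    ...   | refl = d , cd , c≁d
    unique : ∀ {c} → Z c ≡ true → c ≡ a
    unique zc with on-e₀ za | on-e₀ zc
    ... | d , ad , a≁d | _ , cd′ , _ with EndsAre-endpoint H (lift e₀) ad cd′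
    ...   | inj₁ c≡a = c≡a
    ...   | inj₂ c≡d = ⊥-elim (a≁d (trans (Z⊆v za) (trans (sym (Z⊆v zc)) (cong own c≡d))))

  saturated-3-cut : Essentially4EdgeConnected G → ∀ {X} → Saturated X → cut H X ≡ 3 →
                    size H X ≡ 1 ⊎ size H (compl H X) ≡ 1
  saturated-3-cut (ec , small) {X} sat cut≡3 =
    Sum.map (λ size≡1 → singleton-lift W X (saturated-project sat) size≡1 cutW≡3)
            (λ size≡1 → singleton-lift (compl G W) (compl H X) (λ a → cong not (saturated-project sat a))
                                        size≡1 (trans (cut-compl G W) cutW≡3))
            (small W cutW≡3)
    where
    W = project X
    cut≢0 : cut H X ≢ 0
    cut≢0 eq = case trans (sym cut≡3) eq of λ ()
    cutW≡3 : cut G W ≡ 3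
    cutW≡3 = ≤-antisym (≤-trans (saturated-cut sat) (≤-reflexive cut≡3))
               (ec W (saturated-nonemptyProper sat (cut≢0⇒nonemptyProper H X cut≢0)))

  lone-lift-crossing : ∀ {X v e₀} → DelEdgeConnected 2 G v → Split X v → SaturatedAway X v →
                       (∀ {e} → crosses H X (lift e) ≡ true → e ≡ e₀) →
                       size H X ≡ 1 ⊎ size H (compl H X) ≡ 1
  lone-lift-crossing {X} {v} conn₂ (a , b , _ , _ , xa , xb) sat only-e₀
    with any? (λ u → ¬? (u ≟ v) ×-dec (projectAway X v u ≟ᵇ true))
       | any? (λ u → ¬? (u ≟ v) ×-dec (projectAway X v u ≟ᵇ false))
  ... | yes (u , _ , in-u) | yes (u′ , u′≢v , out-u′) =
    case ≤-trans (conn₂ (projectAway X v) (projectAway-self X v) (u , in-u) (u′ , u′≢v , out-u′))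
                 (≤-trans (cutDel≤lift-crossings sat)
                          (count-≤1 _ (λ ci cj → trans (only-e₀ ci) (sym (only-e₀ cj)))))
    of λ { (s≤s ()) }
  ... | no none-in | _ = inj₁ (inside-class-size X (confined sat none-in) only-e₀ xa)
  ... | _ | no none-out =
    inj₂ (inside-class-size (compl H X) (λ xc → confined sat none-out (not-injective xc))
                            (λ {e} ce → only-e₀ (trans (sym (crosses-compl H X (lift e))) ce)) (cong not xb))

  split-3-cut : ∀ {X v} → DelEdgeConnected 2 G v → Split X v → SaturatedAway X v → cut H X ≡ 3 →
                size H X ≡ 1 ⊎ size H (compl H X) ≡ 1
  split-3-cut {X} {v} conn₂ s sat cut≡3
    with split⇒lift-crossing s sat (delEdgeConnected-mono G (s≤s z≤n) conn₂)
  ... | e₀ , ce₀ = lone-lift-crossing conn₂ s sat only-e₀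
    where
    only-e₀ : ∀ {e} → crosses H X (lift e) ≡ true → e ≡ e₀
    only-e₀ {e} ce with e ≟ e₀
    ... | yes e≡e₀ = e≡e₀
    ... | no e≢e₀ with subst (4 ≤_) cut≡3 (cycleCut+two-lifts (split⇒cycleCut s) e≢e₀ ce ce₀)
    ...   | s≤s (s≤s (s≤s ()))

  essentially4EdgeConnected : Essentially4EdgeConnected G → (∀ v → DelEdgeConnected 2 G v) →
                              Essentially4EdgeConnected H
  essentially4EdgeConnected ess@(ec , _) conn₂ =
    edgeConnected ec (λ v → delEdgeConnected-mono G (s≤s z≤n) (conn₂ v)) , trivial-3-cuts
    where
    trivial-3-cuts : ∀ X → cut H X ≡ 3 → size H X ≡ 1 ⊎ size H (compl H X) ≡ 1
    trivial-3-cuts X cut≡3 with any? (split? X)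
    ... | no none = saturated-3-cut ess (no-split⇒saturated none) cut≡3
    ... | yes (v , s) with split-elsewhere? X v
    ...   | no none = split-3-cut (conn₂ v) s (no-split-elsewhere⇒saturatedAway none) cut≡3
    ...   | yes (w , w≢v , s′)
      with subst (4 ≤_) cut≡3 (two-cycleCuts (≢-sym w≢v) (split⇒cycleCut s) (split⇒cycleCut s′))
    ...     | s≤s (s≤s (s≤s ()))

proposition7 : (G H : Graph) → MinDegAtLeast 3 G → CubicExtension G H →
    ((EdgeConnected 3 G × (∀ v → DelConnected G v)) → EdgeConnected 3 H) ×
    ((Essentially4EdgeConnected G × (∀ v → DelEdgeConnected 2 G v)) →
      Essentially4EdgeConnected H)
proposition7 G H minDeg ext = uncurry edgeConnected , uncurry essentially4EdgeConnected
  where open CubicExtensionProperties minDeg ext
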